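{- Let $L$ be a Latin square of order $n\ge2$ in which the minimum deficit of a partial transversal is $d$. Then: (1) the minimum size of a cover of $L$ is $n+\lceil d/2 \rceil$; (2) any partial transversal of $L$ of deficit $d$ is contained in a minimum cover of $L$; (3) any minimum cover of $L$ contains a partial transversal of deficit $d$ if $d$ is even, or of deficit $d+1$ if $d$ is odd; (4) if $d$ is even, then for any minimum cover $\mathscr{C}$ of $L$ and any entry $\mathbf{e}\in\mathscr{C}$, $\mathscr{C}$ contains a partial transversal of deficit $d$ that contains $\mathbf{e}$.
   Context: A Latin square of order $n$ is an $n\times n$ array on $n$ symbols in which each symbol occurs once in each row and each column; its set of entries is $E(L)=\{(i,j,L_{ij})\}$. A line is the set of all entries in a given row, in a given column, or with a given symbol. A cover is a subset of $E(L)$ meeting every line; a cover is minimum if no cover of $L$ has smaller size. A partial transversal of deficit $d$ is an $(n-d)$-subset of $E(L)$ in which every line is represented at most once. -}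

module Defs where

open import Data.Nat using (ℕ; _+_; _≤_)
open import Data.Fin using (Fin)
open import Data.Product using (_×_; Σ; ∃; _,_; proj₁; proj₂)
open import Data.List using (List; length)
open import Data.List.Membership.Propositional using (_∈_)
open import Data.List.Relation.Unary.Unique.Propositional using (Unique)
open import Data.List.Relation.Binary.Subset.Propositional using (_⊆_)
open import Function.Definitions using (Injective)
open import Relation.Binary.PropositionalEquality using (_≡_)

Square : ℕ → Set
Square n = Fin n → Fin n → Fin n

IsLatin : {n : ℕ} → Square n → Set
IsLatin {n} L =
  (∀ (i s : Fin n) → Σ (Fin n) λ j → L i j ≡ s) ×
  (∀ (i : Fin n) → Injective _≡_ _≡_ (λ j → L i j)) ×
  (∀ (j s : Fin n) → Σ (Fin n) λ i → L i j ≡ s) ×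
  (∀ (j : Fin n) → Injective _≡_ _≡_ (λ i → L i j))

-- An entry (i , j , L i j) of E(L) is determined by its cell (i , j);
-- a subset of E(L) is represented by a duplicate-free list of cells.
Cell : ℕ → Set
Cell n = Fin n × Fin n

row col : {n : ℕ} → Cell n → Fin n
row = proj₁
col = proj₂

sym : {n : ℕ} → Square n → Cell n → Fin n
sym L c = L (proj₁ c) (proj₂ c)

EntrySet : ℕ → Set
EntrySet n = List (Cell n)

IsCover : {n : ℕ} → Square n → EntrySet n → Set
IsCover {n} L C =
  Unique C ×
  (∀ (i : Fin n) → ∃ λ c → c ∈ C × row c ≡ i) ×
  (∀ (j : Fin n) → ∃ λ c → c ∈ C × col c ≡ j) ×
  (∀ (s : Fin n) → ∃ λ c → c ∈ C × sym L c ≡ s)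

IsMinCover : {n : ℕ} → Square n → EntrySet n → Set
IsMinCover L C = IsCover L C × (∀ C′ → IsCover L C′ → length C ≤ length C′)

LinesAtMostOnce : {n : ℕ} → Square n → EntrySet n → Set
LinesAtMostOnce L T =
  ∀ c c′ → c ∈ T → c′ ∈ T →
    (row c ≡ row c′ → c ≡ c′) × (col c ≡ col c′ → c ≡ c′) × (sym L c ≡ sym L c′ → c ≡ c′)

IsPT : {n : ℕ} → Square n → ℕ → EntrySet n → Set
IsPT {n} L d T = Unique T × length T + d ≡ n × LinesAtMostOnce L T

MinDeficit : {n : ℕ} → Square n → ℕ → Set
MinDeficit L d = (∃ λ T → IsPT L d T) × (∀ e T → IsPT L e T → d ≤ e)

module Submission where

open import Defs
open import Data.Nat using (ℕ; suc; _+_; _≤_; ⌈_/2⌉)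
open import Data.Nat.Divisibility using (_∣_)
open import Data.Fin using (Fin)
open import Data.Product using (_×_; ∃)
open import Data.List using (length)
open import Data.List.Membership.Propositional using (_∈_)
open import Data.List.Relation.Binary.Subset.Propositional using (_⊆_)
open import Relation.Nullary using (¬_)
open import Relation.Binary.PropositionalEquality using (_≡_)

open import Level using (0ℓ)
open import Data.Nat using (zero; _*_; _∸_; _<_; ⌊_/2⌋; z≤n; s≤s)
open import Data.Nat.Properties
  using (module ≤-Reasoning; +-suc; +-assoc; +-comm; *-comm; +-identityʳ;
         ≤-refl; ≤-reflexive; ≤-trans; ≤-antisym; <⇒≤;
         +-mono-≤; +-monoˡ-≤; +-monoʳ-≤; +-cancelˡ-≤; +-cancelʳ-≤; m≤m+n; m≤n⇒m≤1+n; m⊓n≤m; m≤n⇒m⊓n≡m;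
         m≤n+o⇒m∸n≤o; m+[n∸m]≡n; m∸n+n≡m; ⌈n/2⌉-mono; n≡⌈n+n/2⌉; ⌊n/2⌋+⌈n/2⌉≡n; ⌊n/2⌋≤⌈n/2⌉)
open import Data.Nat.Divisibility using (divides)
open import Data.Nat.Tactic.RingSolver using (solve-∀)
open import Data.Fin using (fromℕ<)
open import Data.Fin.Properties using (_≟_; injective⇒≤)
open import Data.Product using (_,_; proj₁; proj₂)
open import Data.Product.Properties using (≡-dec)
open import Data.Sum using (_⊎_; inj₁; inj₂)
open import Data.Empty using (⊥-elim)
open import Data.List using (List; []; _∷_; filter; map; take; drop; _++_; lookup; allFin; deduplicate)
open import Data.List.Properties
  using (length-map; length-++; length-take; length-drop; length-tabulate; take++drop≡id; length-deduplicate)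
open import Data.List.Relation.Unary.Any as Any using (Any; here; there)
open import Data.List.Relation.Unary.Any.Properties using (lookup-index)
open import Data.List.Relation.Unary.All as All using ([])
open import Data.List.Relation.Unary.AllPairs using ([]; _∷_)
open import Data.List.Membership.Propositional using (find; lose)
open import Data.List.Membership.Propositional.Properties
  using (∈-++⁺ˡ; ∈-++⁻; ∈-map⁺; ∈-lookup; ∈-filter⁺; ∈-filter⁻; ∈-allFin; ∈-deduplicate⁺)
open import Data.List.Relation.Binary.Subset.Propositional.Properties
  using (⊆-trans; xs⊆xs++ys; xs⊆ys++xs; filter-⊆)
open import Data.List.Relation.Unary.Unique.Propositional using (Unique)
import Data.List.Relation.Unary.Unique.Propositional.Properties as Unique
open import Data.List.Relation.Unary.Unique.DecPropositional.Properties using (deduplicate-!)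
open import Function.Definitions using (Injective)
open import Relation.Nullary using (yes; no)
open import Relation.Unary using (Pred; Decidable)
open import Relation.Unary.Properties using (∁?; _∩?_)
open import Relation.Binary.Definitions using (DecidableEquality)
import Relation.Binary.PropositionalEquality as ≡
open ≡ using (refl)

-- A partial transversal T of deficit d misses d rows,
-- d columns and d symbols.  Pairing k = ⌈d/2⌉ missing rows with k missing columns,
-- the other j = ⌊d/2⌋ rows with j missing symbols, and the remaining columns with the
-- remaining symbols, each pair is met by one entry of L; so T extends to a cover of
-- size at most n - d + (k + j + k) = n + ⌈d/2⌉.
--
-- In a cover C fix a representative of every row, column
-- and symbol.  The entries representing all three of their lines form a partial
-- transversal T ⊆ C, and inclusion–exclusion gives 3n ≤ |T| + 2|C|.  With |T| ≤ n - d
-- this yields |C| ≥ n + ⌈d/2⌉, hence part (1) and, via the extension, part (2).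
-- For a minimum cover, |C| = n + ⌈d/2⌉ forces |T| ≥ n - 2⌈d/2⌉, giving part (3) after
-- truncating T; for part (4) the representatives are chosen through the entry e.

module ListFacts where

  private
    variable
      A B C : Set

  unique-lookup-injective : ∀ {xs : List A} → Unique xs → Injective _≡_ _≡_ (lookup xs)
  unique-lookup-injective (_ ∷ _) {Fin.zero} {Fin.zero} _ = refl
  unique-lookup-injective (x∉ ∷ _) {Fin.zero} {Fin.suc j} eq = ⊥-elim (All.lookup x∉ (∈-lookup j) eq)
  unique-lookup-injective (x∉ ∷ _) {Fin.suc i} {Fin.zero} eq = ⊥-elim (All.lookup x∉ (∈-lookup i) (≡.sym eq))
  unique-lookup-injective (_ ∷ u) {Fin.suc i} {Fin.suc j} eq = ≡.cong Fin.suc (unique-lookup-injective u eq)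

  injective-family-length : ∀ {m} (f : Fin m → A) → Injective _≡_ _≡_ f →
                            (xs : List A) → (∀ k → f k ∈ xs) → m ≤ length xs
  injective-family-length {m = m} f f-inj xs f∈xs = injective⇒≤ position-injective
    where
    position : Fin m → Fin (length xs)
    position k = Any.index (f∈xs k)
    position-injective : Injective _≡_ _≡_ position
    position-injective {i} {j} eq =
      f-inj (≡.trans (lookup-index (f∈xs i)) (≡.trans (≡.cong (lookup xs) eq) (≡.sym (lookup-index (f∈xs j)))))

  filter-split : {P : Pred A 0ℓ} (P? : Decidable P) (xs : List A) →
                 length (filter P? xs) + length (filter (∁? P?) xs) ≡ length xs
  filter-split P? [] = refl
  filter-split P? (x ∷ xs) with P? x
  ... | yes _ = ≡.cong suc (filter-split P? xs)
  ... | no _  = ≡.trans (+-suc _ _) (≡.cong suc (filter-split P? xs))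

  filter-inclusion-exclusion : {P Q : Pred A 0ℓ} (P? : Decidable P) (Q? : Decidable Q) (xs : List A) →
    length (filter P? xs) + length (filter Q? xs) ≤ length xs + length (filter (P? ∩? Q?) xs)
  filter-inclusion-exclusion P? Q? [] = z≤n
  filter-inclusion-exclusion P? Q? (x ∷ xs) with ih ← filter-inclusion-exclusion P? Q? xs | P? x | Q? x
  ... | yes _ | yes _ rewrite +-suc (length (filter P? xs)) (length (filter Q? xs))
                            | +-suc (length xs) (length (filter (P? ∩? Q?) xs)) = s≤s (s≤s ih)
  ... | yes _ | no _  = s≤s ih
  ... | no _  | yes _ rewrite +-suc (length (filter P? xs)) (length (filter Q? xs)) = s≤s ih
  ... | no _  | no _  = m≤n⇒m≤1+n ih

  ∈-take⊎drop : ∀ k (xs : List A) {x} → x ∈ xs → x ∈ take k xs ⊎ x ∈ drop k xs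
  ∈-take⊎drop k xs x∈xs = ∈-++⁻ (take k xs) (≡.subst (_ ∈_) (≡.sym (take++drop≡id k xs)) x∈xs)

  take-⊆ : ∀ k (xs : List A) → take k xs ⊆ xs
  take-⊆ k xs x∈ = ≡.subst (_ ∈_) (take++drop≡id k xs) (∈-++⁺ˡ x∈)

  length-take-≤ : ∀ k (xs : List A) → length (take k xs) ≤ k
  length-take-≤ k xs = ≡.subst (_≤ k) (≡.sym (length-take k xs)) (m⊓n≤m k (length xs))

  length-drop-≤ : ∀ k {o} (xs : List A) → length xs ≤ k + o → length (drop k xs) ≤ o
  length-drop-≤ k xs le = ≡.subst (_≤ _) (≡.sym (length-drop k xs)) (m≤n+o⇒m∸n≤o (length xs) k le)

  Covers : (π : C → A) → List A → List C → Set
  Covers π I cs = ∀ {i} → i ∈ I → ∃ λ c → c ∈ cs × π c ≡ i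

  covers-⊆ : {π : C → A} {I : List A} {cs cs′ : List C} → cs ⊆ cs′ → Covers π I cs → Covers π I cs′
  covers-⊆ sub cov i∈I with c , c∈ , πc ← cov i∈I = c , sub c∈ , πc

  covers-take-drop : {π : C → A} (k : ℕ) {I : List A} {cs : List C} →
                     Covers π (take k I) cs → Covers π (drop k I) cs → Covers π I cs
  covers-take-drop k {I} front back i∈I with ∈-take⊎drop k I i∈I
  ... | inj₁ i∈front = front i∈front
  ... | inj₂ i∈back  = back i∈back

  zipPad : (A → B → C) → (A → C) → (B → C) → List A → List B → List C
  zipPad f g h []       ys       = map h ys
  zipPad f g h (x ∷ xs) []       = map g (x ∷ xs)
  zipPad f g h (x ∷ xs) (y ∷ ys) = f x y ∷ zipPad f g h xs ys

  module _ (f : A → B → C) (g : A → C) (h : B → C) where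

    zipPad-length : ∀ m (xs : List A) (ys : List B) → length xs ≤ m → length ys ≤ m →
                    length (zipPad f g h xs ys) ≤ m
    zipPad-length m [] ys _ ys≤m = ≡.subst (_≤ m) (≡.sym (length-map h ys)) ys≤m
    zipPad-length m (x ∷ xs) [] xs≤m _ = ≡.subst (_≤ m) (≡.sym (length-map g (x ∷ xs))) xs≤m
    zipPad-length (suc m) (x ∷ xs) (y ∷ ys) (s≤s xs≤m) (s≤s ys≤m) = s≤s (zipPad-length m xs ys xs≤m ys≤m)

    zipPad-coversˡ : (π : C → A) → (∀ x y → π (f x y) ≡ x) → (∀ x → π (g x) ≡ x) →
                     ∀ xs ys → Covers π xs (zipPad f g h xs ys)
    zipPad-coversˡ π πf πg (x ∷ xs) [] {i} i∈ = g i , ∈-map⁺ g i∈ , πg i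
    zipPad-coversˡ π πf πg (x ∷ xs) (y ∷ ys) (here refl) = f x y , here refl , πf x y
    zipPad-coversˡ π πf πg (x ∷ xs) (y ∷ ys) (there i∈) with c , c∈ , πc ← zipPad-coversˡ π πf πg xs ys i∈ =
      c , there c∈ , πc

    zipPad-coversʳ : (π : C → B) → (∀ x y → π (f x y) ≡ y) → (∀ y → π (h y) ≡ y) →
                     ∀ xs ys → Covers π ys (zipPad f g h xs ys)
    zipPad-coversʳ π πf πh [] ys {i} i∈ = h i , ∈-map⁺ h i∈ , πh i
    zipPad-coversʳ π πf πh (x ∷ xs) (y ∷ ys) (here refl) = f x y , here refl , πf x y
    zipPad-coversʳ π πf πh (x ∷ xs) (y ∷ ys) (there i∈) with c , c∈ , πc ← zipPad-coversʳ π πf πh xs ys i∈ =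
      c , there c∈ , πc

open ListFacts

module Arithmetic where

  ⌈2a+d/2⌉≡a+⌈d/2⌉ : ∀ a d → ⌈ a + a + d /2⌉ ≡ a + ⌈ d /2⌉
  ⌈2a+d/2⌉≡a+⌈d/2⌉ zero    d = refl
  ⌈2a+d/2⌉≡a+⌈d/2⌉ (suc a) d rewrite +-suc a a = ≡.cong suc (⌈2a+d/2⌉≡a+⌈d/2⌉ a d)

  halve : ∀ a d c → a + a + d ≤ c + c → a + ⌈ d /2⌉ ≤ c
  halve a d c le = begin
    a + ⌈ d /2⌉       ≡⟨ ⌈2a+d/2⌉≡a+⌈d/2⌉ a d ⟨
    ⌈ a + a + d /2⌉   ≤⟨ ⌈n/2⌉-mono le ⟩
    ⌈ c + c /2⌉       ≡⟨ n≡⌈n+n/2⌉ c ⟨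
    c                 ∎
    where open ≤-Reasoning

  ⌈d/2⌉+⌈d/2⌉≤1+d : ∀ d → ⌈ d /2⌉ + ⌈ d /2⌉ ≤ suc d
  ⌈d/2⌉+⌈d/2⌉≤1+d zero = z≤n
  ⌈d/2⌉+⌈d/2⌉≤1+d (suc zero) = ≤-refl
  ⌈d/2⌉+⌈d/2⌉≤1+d (suc (suc d)) rewrite +-suc ⌈ d /2⌉ ⌈ d /2⌉ = s≤s (s≤s (⌈d/2⌉+⌈d/2⌉≤1+d d))

  ⌈d/2⌉+⌈d/2⌉≡d : ∀ d → 2 ∣ d → ⌈ d /2⌉ + ⌈ d /2⌉ ≡ d
  ⌈d/2⌉+⌈d/2⌉≡d .(q * 2) (divides q refl) = begin
    ⌈ q * 2 /2⌉ + ⌈ q * 2 /2⌉  ≡⟨ ≡.cong (λ m → ⌈ m /2⌉ + ⌈ m /2⌉) q*2≡q+q ⟩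
    ⌈ q + q /2⌉ + ⌈ q + q /2⌉  ≡⟨ ≡.cong₂ _+_ (n≡⌈n+n/2⌉ q) (n≡⌈n+n/2⌉ q) ⟨
    q + q                      ≡⟨ q*2≡q+q ⟨
    q * 2                      ∎
    where
    open ≡.≡-Reasoning
    q*2≡q+q : q * 2 ≡ q + q
    q*2≡q+q = ≡.trans (*-comm q 2) (≡.cong (q +_) (+-identityʳ q))

  three-counts : ∀ {n a b s x c t} → n ≤ a → n ≤ b → n ≤ s →
                 a + x ≤ c + t → b + s ≤ c + x → n + n + n ≤ t + (c + c)
  three-counts {n} {a} {b} {s} {x} {c} {t} n≤a n≤b n≤s ax bs = +-cancelʳ-≤ x _ _ (begin
    n + n + n + x        ≤⟨ +-monoˡ-≤ x (+-mono-≤ (+-mono-≤ n≤a n≤b) n≤s) ⟩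
    a + b + s + x        ≡⟨ regroup a b s x ⟩
    (a + x) + (b + s)    ≤⟨ +-mono-≤ ax bs ⟩
    (c + t) + (c + x)    ≡⟨ collect c t x ⟩
    t + (c + c) + x      ∎)
    where
    open ≤-Reasoning
    regroup : ∀ a b s x → a + b + s + x ≡ (a + x) + (b + s)
    regroup = solve-∀
    collect : ∀ c t x → (c + t) + (c + x) ≡ t + (c + c) + x
    collect = solve-∀

  double-bound : ∀ {n t d c} → n + n + n ≤ t + (c + c) → t + d ≤ n → n + n + d ≤ c + c
  double-bound {n} {t} {d} {c} count td = +-cancelʳ-≤ n _ _ (begin
    n + n + d + n        ≡⟨ swap n d ⟩
    n + n + n + d        ≤⟨ +-monoˡ-≤ d count ⟩
    t + (c + c) + d      ≡⟨ rotate t c d ⟩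
    (c + c) + (t + d)    ≤⟨ +-monoʳ-≤ (c + c) td ⟩
    (c + c) + n          ∎)
    where
    open ≤-Reasoning
    swap : ∀ n d → n + n + d + n ≡ n + n + n + d
    swap = solve-∀
    rotate : ∀ t c d → t + (c + c) + d ≡ (c + c) + (t + d)
    rotate = solve-∀

  length-from-count : ∀ {n t c k u} → n + n + n ≤ t + (c + c) → c ≤ n + k → k + k ≤ u → n ≤ t + u
  length-from-count {n} {t} {c} {k} {u} count c≤n+k k+k≤u = +-cancelʳ-≤ (n + n) n (t + u) (begin
    n + (n + n)              ≡⟨ +-assoc n n n ⟨
    n + n + n                ≤⟨ count ⟩
    t + (c + c)              ≤⟨ +-monoʳ-≤ t (+-mono-≤ c≤n+k c≤n+k) ⟩
    t + ((n + k) + (n + k))  ≡⟨ regroup t n k ⟩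
    t + (k + k) + (n + n)    ≤⟨ +-monoˡ-≤ (n + n) (+-monoʳ-≤ t k+k≤u) ⟩
    t + u + (n + n)          ∎)
    where
    open ≤-Reasoning
    regroup : ∀ t n k → t + ((n + k) + (n + k)) ≡ t + (k + k) + (n + n)
    regroup = solve-∀

open Arithmetic

module Lines {A : Set} {n : ℕ} (π : A → Fin n) where

  Meets : List A → Set
  Meets C = ∀ i → ∃ λ c → c ∈ C × π c ≡ i

  meets-⊆ : ∀ {C C′} → C ⊆ C′ → Meets C → Meets C′
  meets-⊆ sub meets i with c , c∈ , πc ← meets i = c , sub c∈ , πc

  AtMostOnce : List A → Set
  AtMostOnce T = ∀ {x y} → x ∈ T → y ∈ T → π x ≡ π y → x ≡ y

  met? : (T : List A) → Decidable (λ i → Any (λ c → π c ≡ i) T)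
  met? T i = Any.any? (λ c → π c ≟ i) T

  missing : List A → List (Fin n)
  missing T = filter (∁? (met? T)) (allFin n)

  met-or-missing : ∀ T i → (∃ λ c → c ∈ T × π c ≡ i) ⊎ i ∈ missing T
  met-or-missing T i with met? T i
  ... | yes i-met = inj₁ (find i-met)
  ... | no i-unmet = inj₂ (∈-filter⁺ (∁? (met? T)) (∈-allFin i) i-unmet)

  meets-from-missing : ∀ {T C} → T ⊆ C → Covers π (missing T) C → Meets C
  meets-from-missing {T} T⊆C covers i with met-or-missing T i
  ... | inj₁ (c , c∈T , πc) = c , T⊆C c∈T , πc
  ... | inj₂ i-missing      = covers i-missing

  missing-length : ∀ {T} → Unique T → AtMostOnce T → length T + length (missing T) ≤ n
  missing-length {T} uT once = begin
    length T + length (missing T)                           ≤⟨ +-monoˡ-≤ _ T≤met ⟩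
    length (filter (met? T) (allFin n)) + length (missing T) ≡⟨ filter-split (met? T) (allFin n) ⟩
    length (allFin n)                                       ≡⟨ length-tabulate (λ i → i) ⟩
    n                                                       ∎
    where
    open ≤-Reasoning
    lineOf : Fin (length T) → Fin n
    lineOf k = π (lookup T k)
    lineOf-injective : Injective _≡_ _≡_ lineOf
    lineOf-injective eq = unique-lookup-injective uT (once (∈-lookup _) (∈-lookup _) eq)
    T≤met : length T ≤ length (filter (met? T) (allFin n))
    T≤met = injective-family-length lineOf lineOf-injective _
              (λ k → ∈-filter⁺ (met? T) (∈-allFin _) (lose (∈-lookup k) refl))

  atMostOnce-length : ∀ {T} → Unique T → AtMostOnce T → length T ≤ n
  atMostOnce-length uT once = ≤-trans (m≤m+n _ _) (missing-length uT once)

  representative : ∀ {C} → Meets C → Fin n → A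
  representative meets i = proj₁ (meets i)

  IsRepresentative : ∀ {C} → Meets C → A → Set
  IsRepresentative meets x = representative meets (π x) ≡ x

  isRepresentative? : DecidableEquality A → ∀ {C} (meets : Meets C) → Decidable (IsRepresentative meets)
  isRepresentative? _≟A_ meets x = representative meets (π x) ≟A x

  representatives-atMostOnce : ∀ {C T} (meets : Meets C) →
                               (∀ {x} → x ∈ T → IsRepresentative meets x) → AtMostOnce T
  representatives-atMostOnce meets reps {x} {y} x∈ y∈ πx≡πy =
    ≡.trans (≡.sym (reps x∈)) (≡.trans (≡.cong (representative meets) πx≡πy) (reps y∈))

  representatives-count : (_≟A_ : DecidableEquality A) → ∀ {C} (meets : Meets C) →
                          n ≤ length (filter (isRepresentative? _≟A_ meets) C)
  representatives-count _≟A_ {C} meets = injective-family-length (representative meets) rep-injective _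
    (λ i → ∈-filter⁺ (isRepresentative? _≟A_ meets) (rep∈C i) (≡.cong (representative meets) (rep-line i)))
    where
    rep∈C : ∀ i → representative meets i ∈ C
    rep∈C i = proj₁ (proj₂ (meets i))
    rep-line : ∀ i → π (representative meets i) ≡ i
    rep-line i = proj₂ (proj₂ (meets i))
    rep-injective : Injective _≡_ _≡_ (representative meets)
    rep-injective {i} {j} eq = ≡.trans (≡.sym (rep-line i)) (≡.trans (≡.cong π eq) (rep-line j))

  meets-through : ∀ {C e} → e ∈ C → Meets C → Meets C
  meets-through {e = e} e∈C meets i with π e ≟ i
  ... | yes πe≡i = e , e∈C , πe≡i
  ... | no _     = meets i

  meets-through-represents : ∀ {C e} (e∈C : e ∈ C) (meets : Meets C) →
                             IsRepresentative (meets-through e∈C meets) e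
  meets-through-represents {e = e} e∈C meets with π e ≟ π e
  ... | yes _   = refl
  ... | no πe≢πe = ⊥-elim (πe≢πe refl)

open Lines

module PartialTransversals {n : ℕ} (L : Square n) where

  rows-once : ∀ {T} → LinesAtMostOnce L T → AtMostOnce row T
  rows-once once x∈ y∈ = proj₁ (once _ _ x∈ y∈)

  cols-once : ∀ {T} → LinesAtMostOnce L T → AtMostOnce col T
  cols-once once x∈ y∈ = proj₁ (proj₂ (once _ _ x∈ y∈))

  syms-once : ∀ {T} → LinesAtMostOnce L T → AtMostOnce (sym L) T
  syms-once once x∈ y∈ = proj₂ (proj₂ (once _ _ x∈ y∈))

  isPT-by-size : ∀ {T} → Unique T → LinesAtMostOnce L T → IsPT L (n ∸ length T) T
  isPT-by-size uT once = uT , m+[n∸m]≡n (atMostOnce-length row uT (rows-once once)) , once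

  size-bound : ∀ {d T} → MinDeficit L d → Unique T → LinesAtMostOnce L T → length T + d ≤ n
  size-bound {d} {T} (_ , minimal) uT once = begin
    length T + d                ≤⟨ +-monoʳ-≤ (length T) (minimal _ T (isPT-by-size uT once)) ⟩
    length T + (n ∸ length T)   ≡⟨ m+[n∸m]≡n (atMostOnce-length row uT (rows-once once)) ⟩
    n                           ∎
    where open ≤-Reasoning

  -- A single entry is a partial transversal, so the minimum deficit is below n.
  minDeficit<n : ∀ {d} → Fin n → MinDeficit L d → d < n
  minDeficit<n i minDeficit = size-bound minDeficit ([] ∷ []) single-entry-once
    where
    single-entry-once : LinesAtMostOnce L ((i , i) ∷ [])
    single-entry-once _ _ (here refl) (here refl) = (λ _ → refl) , (λ _ → refl) , (λ _ → refl)

  truncate : ∀ {t T} → Unique T → LinesAtMostOnce L T → t ≤ n → n ≤ length T + t →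
             IsPT L t (take (n ∸ t) T)
  truncate {t} {T} uT once t≤n n≤T+t =
    Unique.take⁺ (n ∸ t) uT ,
    ≡.trans (≡.cong (_+ t) (≡.trans (length-take (n ∸ t) T) (m≤n⇒m⊓n≡m n∸t≤T))) (m∸n+n≡m t≤n) ,
    λ c c′ c∈ c′∈ → once c c′ (take-⊆ (n ∸ t) T c∈) (take-⊆ (n ∸ t) T c′∈)
    where
    n∸t≤T : n ∸ t ≤ length T
    n∸t≤T = m≤n+o⇒m∸n≤o n t (≡.subst (n ≤_) (+-comm (length T) t) n≤T+t)

_≟ᶜ_ : ∀ {n} → DecidableEquality (Cell n)
_≟ᶜ_ = ≡-dec _≟_ _≟_

-- Extending a partial transversal T of deficit d to a cover of size at most n + ⌈d/2⌉:
-- T misses d rows, d columns and d symbols; these 3d lines are paired off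
-- (row with column, row with symbol, column with symbol) and each pair is
-- covered by the single entry of L lying on both lines.
module Extension {n : ℕ} {L : Square n} (latin : IsLatin L) {d : ℕ} {T : EntrySet n} (pt : IsPT L d T) where

  open PartialTransversals L

  inRowWithSymbol : Fin n → Fin n → Cell n
  inRowWithSymbol r s = r , proj₁ (proj₁ latin r s)

  inColWithSymbol : Fin n → Fin n → Cell n
  inColWithSymbol c s = proj₁ (proj₁ (proj₂ (proj₂ latin)) c s) , c

  inRowWithSymbol-sym : ∀ r s → sym L (inRowWithSymbol r s) ≡ s
  inRowWithSymbol-sym r s = proj₂ (proj₁ latin r s)

  inColWithSymbol-sym : ∀ c s → sym L (inColWithSymbol c s) ≡ s
  inColWithSymbol-sym c s = proj₂ (proj₁ (proj₂ (proj₂ latin)) c s)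

  diagonal : Fin n → Cell n
  diagonal i = i , i

  withSymbol : Fin n → Cell n
  withSymbol s = inRowWithSymbol s s

  k j : ℕ
  k = ⌈ d /2⌉
  j = ⌊ d /2⌋

  missingRows missingCols missingSyms : List (Fin n)
  missingRows = missing row T
  missingCols = missing col T
  missingSyms = missing (sym L) T

  rowsCols rowsSyms colsSyms : EntrySet n
  rowsCols = zipPad _,_ diagonal diagonal (take k missingRows) (take k missingCols)
  rowsSyms = zipPad inRowWithSymbol diagonal withSymbol (drop k missingRows) (take j missingSyms)
  colsSyms = zipPad inColWithSymbol diagonal withSymbol (drop k missingCols) (drop j missingSyms)

  patch : EntrySet n
  patch = rowsCols ++ rowsSyms ++ colsSyms

  extension : EntrySet n
  extension = deduplicate _≟ᶜ_ (T ++ patch)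

  T⊆extension : T ⊆ extension
  T⊆extension = ⊆-trans (xs⊆xs++ys T patch) (∈-deduplicate⁺ _≟ᶜ_)

  private
    within : ∀ {P} → P ⊆ patch → P ⊆ T ++ patch
    within P⊆patch = ⊆-trans P⊆patch (xs⊆ys++xs patch T)

    rowsCols⊆ : rowsCols ⊆ T ++ patch
    rowsCols⊆ = within (xs⊆xs++ys rowsCols _)

    rowsSyms⊆ : rowsSyms ⊆ T ++ patch
    rowsSyms⊆ = within (⊆-trans (xs⊆xs++ys rowsSyms colsSyms) (xs⊆ys++xs _ rowsCols))

    colsSyms⊆ : colsSyms ⊆ T ++ patch
    colsSyms⊆ = within (⊆-trans (xs⊆ys++xs colsSyms rowsSyms) (xs⊆ys++xs _ rowsCols))

  meets-rows : Meets row (T ++ patch)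
  meets-rows = meets-from-missing row (xs⊆xs++ys T patch) (covers-take-drop k
    (covers-⊆ rowsCols⊆ (zipPad-coversˡ _,_ diagonal diagonal row (λ _ _ → refl) (λ _ → refl)
      (take k missingRows) (take k missingCols)))
    (covers-⊆ rowsSyms⊆ (zipPad-coversˡ inRowWithSymbol diagonal withSymbol row (λ _ _ → refl) (λ _ → refl)
      (drop k missingRows) (take j missingSyms))))

  meets-cols : Meets col (T ++ patch)
  meets-cols = meets-from-missing col (xs⊆xs++ys T patch) (covers-take-drop k
    (covers-⊆ rowsCols⊆ (zipPad-coversʳ _,_ diagonal diagonal col (λ _ _ → refl) (λ _ → refl)
      (take k missingRows) (take k missingCols)))
    (covers-⊆ colsSyms⊆ (zipPad-coversˡ inColWithSymbol diagonal withSymbol col (λ _ _ → refl) (λ _ → refl)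
      (drop k missingCols) (drop j missingSyms))))

  meets-syms : Meets (sym L) (T ++ patch)
  meets-syms = meets-from-missing (sym L) (xs⊆xs++ys T patch) (covers-take-drop j
    (covers-⊆ rowsSyms⊆ (zipPad-coversʳ inRowWithSymbol diagonal withSymbol (sym L)
      inRowWithSymbol-sym (λ s → inRowWithSymbol-sym s s) (drop k missingRows) (take j missingSyms)))
    (covers-⊆ colsSyms⊆ (zipPad-coversʳ inColWithSymbol diagonal withSymbol (sym L)
      inColWithSymbol-sym (λ s → inRowWithSymbol-sym s s) (drop k missingCols) (drop j missingSyms))))

  extension-isCover : IsCover L extension
  extension-isCover = deduplicate-! _≟ᶜ_ (T ++ patch) ,
    meets-⊆ row dedup⁺ meets-rows , meets-⊆ col dedup⁺ meets-cols , meets-⊆ (sym L) dedup⁺ meets-syms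
    where
    dedup⁺ : T ++ patch ⊆ extension
    dedup⁺ = ∈-deduplicate⁺ _≟ᶜ_

  private
    T-unique : Unique T
    T-unique = proj₁ pt
    T-size : length T + d ≡ n
    T-size = proj₁ (proj₂ pt)
    T-once : LinesAtMostOnce L T
    T-once = proj₂ (proj₂ pt)

  -- T misses exactly d = k + j lines of each kind; we only need "at most".
  missing≤k+j : (π : Cell n → Fin n) → AtMostOnce π T → length (missing π T) ≤ k + j
  missing≤k+j π once = +-cancelˡ-≤ (length T) _ _ (begin
    length T + length (missing π T)  ≤⟨ missing-length π T-unique once ⟩
    n                                ≡⟨ T-size ⟨
    length T + d                     ≡⟨ ≡.cong (length T +_) (⌊n/2⌋+⌈n/2⌉≡n d) ⟨
    length T + (j + k)               ≡⟨ ≡.cong (length T +_) (+-comm j k) ⟩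
    length T + (k + j)               ∎)
    where open ≤-Reasoning

  rowsCols-length : length rowsCols ≤ k
  rowsCols-length = zipPad-length _,_ diagonal diagonal k
    (take k missingRows) (take k missingCols) (length-take-≤ k missingRows) (length-take-≤ k missingCols)

  rowsSyms-length : length rowsSyms ≤ j
  rowsSyms-length = zipPad-length inRowWithSymbol diagonal withSymbol j
    (drop k missingRows) (take j missingSyms)
    (length-drop-≤ k missingRows (missing≤k+j row (rows-once T-once)))
    (length-take-≤ j missingSyms)

  colsSyms-length : length colsSyms ≤ k
  colsSyms-length = zipPad-length inColWithSymbol diagonal withSymbol k
    (drop k missingCols) (drop j missingSyms)
    (≤-trans (length-drop-≤ k missingCols (missing≤k+j col (cols-once T-once))) (⌊n/2⌋≤⌈n/2⌉ d))
    (length-drop-≤ j missingSyms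
      (≡.subst (length missingSyms ≤_) (+-comm k j) (missing≤k+j (sym L) (syms-once T-once))))

  patch-length : length patch ≤ d + k
  patch-length = begin
    length patch                                           ≡⟨ length-++ rowsCols ⟩
    length rowsCols + length (rowsSyms ++ colsSyms)        ≡⟨ ≡.cong (length rowsCols +_) (length-++ rowsSyms) ⟩
    length rowsCols + (length rowsSyms + length colsSyms)  ≤⟨ +-mono-≤ rowsCols-length
                                                                (+-mono-≤ rowsSyms-length colsSyms-length) ⟩
    k + (j + k)                                            ≡⟨ +-assoc k j k ⟨
    k + j + k                                              ≡⟨ ≡.cong (_+ k) (+-comm k j) ⟩
    j + k + k                                              ≡⟨ ≡.cong (_+ k) (⌊n/2⌋+⌈n/2⌉≡n d) ⟩
    d + k                                                  ∎
    where open ≤-Reasoning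

  extension-length : length extension ≤ n + k
  extension-length = begin
    length extension            ≤⟨ length-deduplicate _≟ᶜ_ (T ++ patch) ⟩
    length (T ++ patch)         ≡⟨ length-++ T ⟩
    length T + length patch     ≤⟨ +-monoʳ-≤ (length T) patch-length ⟩
    length T + (d + k)          ≡⟨ +-assoc (length T) d k ⟨
    length T + d + k            ≡⟨ ≡.cong (_+ k) T-size ⟩
    n + k                       ∎
    where open ≤-Reasoning

-- Extracting a partial transversal from a cover C: fix a representative in C of every
-- row, column and symbol. The entries representing all three of their lines form a
-- partial transversal inside C, and by inclusion–exclusion 3n ≤ |T| + 2|C|.
module Extraction {n : ℕ} {L : Square n} {C : EntrySet n} (C-unique : Unique C)
                  (rows : Meets row C) (cols : Meets col C) (syms : Meets (sym L) C) where

  Represents : Cell n → Set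
  Represents x = IsRepresentative row rows x × IsRepresentative col cols x × IsRepresentative (sym L) syms x

  private
    rowRep? : Decidable (IsRepresentative row rows)
    rowRep? = isRepresentative? row _≟ᶜ_ rows
    colRep? : Decidable (IsRepresentative col cols)
    colRep? = isRepresentative? col _≟ᶜ_ cols
    symRep? : Decidable (IsRepresentative (sym L) syms)
    symRep? = isRepresentative? (sym L) _≟ᶜ_ syms

  represents? : Decidable Represents
  represents? = rowRep? ∩? (colRep? ∩? symRep?)

  transversal : EntrySet n
  transversal = filter represents? C

  transversal-⊆ : transversal ⊆ C
  transversal-⊆ = filter-⊆ represents? C

  transversal-unique : Unique transversal
  transversal-unique = Unique.filter⁺ represents? C-unique

  -- Representatives of a common line coincide, so the transversal meets each line at most once.
  transversal-once : LinesAtMostOnce L transversal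
  transversal-once c c′ c∈ c′∈ =
    representatives-atMostOnce row rows (λ x∈ → proj₁ (represents x∈)) c∈ c′∈ ,
    representatives-atMostOnce col cols (λ x∈ → proj₁ (proj₂ (represents x∈))) c∈ c′∈ ,
    representatives-atMostOnce (sym L) syms (λ x∈ → proj₂ (proj₂ (represents x∈))) c∈ c′∈
    where
    represents : ∀ {x} → x ∈ transversal → Represents x
    represents x∈ = proj₂ (∈-filter⁻ represents? {xs = C} x∈)

  representative-∈ : ∀ {e} → e ∈ C → IsRepresentative row rows e → IsRepresentative col cols e →
                     IsRepresentative (sym L) syms e → e ∈ transversal
  representative-∈ e∈C r c s = ∈-filter⁺ represents? e∈C (r , c , s)

  -- Each line has a distinct representative in C, so at least n entries represent their row
  -- (column, symbol); inclusion–exclusion then bounds the entries representing all three.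
  transversal-count : n + n + n ≤ length transversal + (length C + length C)
  transversal-count = three-counts
    (representatives-count row _≟ᶜ_ rows) (representatives-count col _≟ᶜ_ cols)
    (representatives-count (sym L) _≟ᶜ_ syms)
    (filter-inclusion-exclusion rowRep? (colRep? ∩? symRep?) C)
    (filter-inclusion-exclusion colRep? symRep? C)

module MinimumCovers {n : ℕ} {L : Square n} (latin : IsLatin L) {d : ℕ} (minDeficit : MinDeficit L d) where

  open PartialTransversals L

  cover-lower-bound : ∀ C → IsCover L C → n + ⌈ d /2⌉ ≤ length C
  cover-lower-bound C (C-unique , rows , cols , syms) =
    halve n d (length C)
      (double-bound {c = length C} transversal-count (size-bound minDeficit transversal-unique transversal-once))
    where open Extraction C-unique rows cols syms

  minimum-cover-through : ∀ T → IsPT L d T → ∃ λ C → IsMinCover L C × T ⊆ C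
  minimum-cover-through T pt =
    extension , (extension-isCover , λ C′ C′-cover → ≤-trans extension-length (cover-lower-bound C′ C′-cover)) ,
    T⊆extension
    where open Extension latin pt

  minimum-cover-size : ∃ λ C → IsCover L C × length C ≡ n + ⌈ d /2⌉
  minimum-cover-size =
    extension , extension-isCover , ≤-antisym extension-length (cover-lower-bound extension extension-isCover)
    where open Extension latin (proj₂ (proj₁ minDeficit))

  minimum-cover-length : ∀ {C} → IsMinCover L C → length C ≤ n + ⌈ d /2⌉
  minimum-cover-length (_ , minimal) = ≤-trans (minimal _ extension-isCover) extension-length
    where open Extension latin (proj₂ (proj₁ minDeficit))

  transversal-in-minimum-cover : ∀ {u} C → IsMinCover L C → ⌈ d /2⌉ + ⌈ d /2⌉ ≤ u → u ≤ n →
                                 ∃ λ T → IsPT L u T × T ⊆ C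
  transversal-in-minimum-cover {u} C C-min@((C-unique , rows , cols , syms) , _) 2k≤u u≤n =
    take (n ∸ u) transversal ,
    truncate transversal-unique transversal-once u≤n
      (length-from-count {c = length C} transversal-count (minimum-cover-length C-min) 2k≤u) ,
    ⊆-trans (take-⊆ (n ∸ u) transversal) transversal-⊆
    where open Extraction C-unique rows cols syms

  -- For even d, choosing e as representative of its three lines yields a deficit-d
  -- partial transversal in C through e: it is large enough by counting and no larger by minimality.
  transversal-through : 2 ∣ d → ∀ C → IsMinCover L C → ∀ e → e ∈ C →
                        ∃ λ T → IsPT L d T × T ⊆ C × e ∈ T
  transversal-through d-even C C-min@((C-unique , rows , cols , syms) , _) e e∈C =
    transversal ,
    (transversal-unique , ≤-antisym (size-bound minDeficit transversal-unique transversal-once) large ,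
     transversal-once) ,
    transversal-⊆ ,
    representative-∈ e∈C (meets-through-represents row e∈C rows) (meets-through-represents col e∈C cols)
                         (meets-through-represents (sym L) e∈C syms)
    where
    open Extraction C-unique (meets-through row e∈C rows) (meets-through col e∈C cols)
                             (meets-through (sym L) e∈C syms)
    large : n ≤ length transversal + d
    large = length-from-count {c = length C} transversal-count (minimum-cover-length C-min)
                              (≤-reflexive (⌈d/2⌉+⌈d/2⌉≡d d d-even))

theorem2p5 : (n : ℕ) → 2 ≤ n → (L : Square n) → IsLatin L → (d : ℕ) → MinDeficit L d →
    ((∃ λ C → IsCover L C × length C ≡ n + ⌈ d /2⌉) ×
     (∀ C → IsCover L C → n + ⌈ d /2⌉ ≤ length C)) ×
    (∀ T → IsPT L d T → ∃ λ C → IsMinCover L C × T ⊆ C) ×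
    (∀ C → IsMinCover L C →
       (2 ∣ d → ∃ λ T → IsPT L d T × T ⊆ C) ×
       (¬ (2 ∣ d) → ∃ λ T → IsPT L (suc d) T × T ⊆ C)) ×
    (2 ∣ d → ∀ C → IsMinCover L C → ∀ e → e ∈ C →
       ∃ λ T → IsPT L d T × T ⊆ C × e ∈ T)
theorem2p5 n 2≤n L latin d minDeficit =
  (minimum-cover-size , cover-lower-bound) ,
  minimum-cover-through ,
  (λ C C-min →
    (λ d-even → transversal-in-minimum-cover C C-min (≤-reflexive (⌈d/2⌉+⌈d/2⌉≡d d d-even)) (<⇒≤ d<n)) ,
    (λ _ → transversal-in-minimum-cover C C-min (⌈d/2⌉+⌈d/2⌉≤1+d d) d<n)) ,
  transversal-through
  where
  open MinimumCovers latin minDeficit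
  -- Order n ≥ 2 provides a cell, hence d < n.
  d<n : d < n
  d<n = PartialTransversals.minDeficit<n L (fromℕ< 2≤n) minDeficit
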